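{- Let $i:*\to X$ be an HDA and $(\tilde x_1,\dots,\tilde x_m)$ a pointed cube path in its unfolding $\tilde X$. Then $(\pi_X\tilde x_1,\dots,\pi_X\tilde x_j)\in\tilde x_j$ for all $j=1,\dots,m$.
   Context: A precubical set $X$: sets $(X_n)_{n\in\mathbb N}$ with face maps $\delta_k^\nu:X_n\to X_{n-1}$ ($n\ge1$, $1\le k\le n$, $\nu\in\{0,1\}$), $\delta_k^\nu\delta_\ell^\mu=\delta_{\ell-1}^\mu\delta_k^\nu$ for $k<\ell$. An HDA $i:*\to X$ is a precubical set with distinguished $0$-cube $i$. A cube path is a sequence $(x_1,\dots,x_m)$ with, for each $j<m$, some $k$ with $x_j=\delta_k^0x_{j+1}$ or $x_{j+1}=\delta_k^1x_j$; pointed if $x_1$ is the base point. Adjacency of $(x_1,\dots,x_m)$, $(y_1,\dots,y_m)$: $x_1=y_1$, $x_m=y_m$, differ at exactly one index $p$, and for some $k<\ell$ (possibly with roles exchanged): (a) $x_{p-1}=\delta_k^0x_p$, $x_p=\delta_\ell^0x_{p+1}$, $y_{p-1}=\delta_{\ell-1}^0y_p$, $y_p=\delta_k^0y_{p+1}$; or (b) $x_p=\delta_k^1x_{p-1}$, $x_{p+1}=\delta_\ell^1x_p$, $y_p=\delta_{\ell-1}^1y_{p-1}$, $y_{p+1}=\delta_k^1y_p$; or (c) $x_p=\delta_k^0\delta_\ell^1y_p$, $y_{p-1}=\delta_k^0y_p$, $y_{p+1}=\delta_\ell^1y_p$; or (d) $x_p=\delta_k^1\delta_\ell^0y_p$,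 $y_{p-1}=\delta_\ell^0y_p$, $y_{p+1}=\delta_k^1y_p$. Homotopy $\sim$ = reflexive transitive closure; $[x_1,\dots,x_m]$ is the class. Unfolding: $\tilde X_n$ = homotopy classes $[x_1,\dots,x_m]$ of pointed cube paths in $X$ with $x_m\in X_n$, base point $[i]$, $\tilde\delta_k^0[x_1,\dots,x_m]=\{(y_1,\dots,y_p)\mid y_p=\delta_k^0x_m,(y_1,\dots,y_p,x_m)\sim(x_1,\dots,x_m)\}$, $\tilde\delta_k^1[x_1,\dots,x_m]=[x_1,\dots,x_m,\delta_k^1x_m]$; this is a pointed precubical set and $\pi_X:\tilde X\to X$, $\pi_X[x_1,\dots,x_m]=x_m$, is a pointed precubical morphism. -}

module Defs where

open import Data.Nat using (ℕ; zero; suc; _<_; _≤_; _∸_)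
open import Data.Fin using (Fin; toℕ; inject₁)
open import Data.Bool using (Bool; true; false)
open import Data.List using (List; []; _∷_; _++_; _∷ʳ_; map; take; length)
open import Data.List.Relation.Unary.Linked using (Linked)
open import Data.Product using (Σ; ∃; ∃-syntax; _×_; _,_; proj₁; proj₂)
open import Data.Sum using (_⊎_)
open import Function.Bundles using (_⇔_)
open import Relation.Binary.PropositionalEquality using (_≡_)
open import Relation.Binary.Construct.Closure.ReflexiveTransitive using (Star)

-- Face maps are 0-indexed: δ k ν : X (suc n) → X n with
-- k : Fin (suc n) standing for the paper's index k+1 ∈ {1,…,n+1}.
-- The relation δ_k δ_ℓ = δ_{ℓ-1} δ_k (k < ℓ, 1-indexed) becomes, writing
-- the paper's ℓ as suc ℓ' (0-indexed), k ≤ ℓ'.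
record PreCubical : Set₁ where
  field
    X : ℕ → Set
    δ : ∀ {n} → Fin (suc n) → Bool → X (suc n) → X n
    δ-rel : ∀ {n} (k ℓ : Fin (suc n)) (ν μ : Bool) (x : X (suc (suc n))) →
            toℕ k ≤ toℕ ℓ →
            δ k ν (δ (Data.Fin.suc ℓ) μ x) ≡ δ ℓ μ (δ (inject₁ k) ν x)

module Unfolding (P : PreCubical) (i : PreCubical.X P 0) where
  open PreCubical P

  Cell : Set
  Cell = Σ ℕ X

  data _≡δ⟨_,_⟩_ : Cell → ℕ → Bool → Cell → Set where
    face : ∀ {n} (k : Fin (suc n)) (ν : Bool) (y : X (suc n)) →
           (n , δ k ν y) ≡δ⟨ toℕ k , ν ⟩ (suc n , y)

  Step : Cell → Cell → Set
  Step a b = ∃[ k ] (a ≡δ⟨ k , false ⟩ b ⊎ b ≡δ⟨ k , true ⟩ a)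

  IsCubePath : List Cell → Set
  IsCubePath = Linked Step

  base : Cell
  base = (0 , i)

  IsPointedCubePath : List Cell → Set
  IsPointedCubePath xs = Σ (List Cell) λ rest → (xs ≡ base ∷ rest) × IsCubePath xs

  -- Adjacency (one direction; "roles exchanged" is the symmetrisation below).
  -- The differing index p is the middle element b / b'. Indices 0-based,
  -- so ℓ-1 is ℓ ∸ 1 (with k < ℓ).
  Adj₀ : List Cell → List Cell → Set
  Adj₀ xs ys =
    Σ (List Cell) λ pre → Σ Cell λ a → Σ Cell λ b → Σ Cell λ b' → Σ Cell λ c →
    Σ (List Cell) λ post →
    (xs ≡ pre ++ a ∷ b ∷ c ∷ post) × (ys ≡ pre ++ a ∷ b' ∷ c ∷ post) ×
    Σ ℕ λ k → Σ ℕ λ ℓ → k < ℓ ×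
      (
        (a ≡δ⟨ k , false ⟩ b × b ≡δ⟨ ℓ , false ⟩ c ×
         a ≡δ⟨ ℓ ∸ 1 , false ⟩ b' × b' ≡δ⟨ k , false ⟩ c)
      ⊎
        (b ≡δ⟨ k , true ⟩ a × c ≡δ⟨ ℓ , true ⟩ b ×
         b' ≡δ⟨ ℓ ∸ 1 , true ⟩ a × c ≡δ⟨ k , true ⟩ b')
      ⊎
        ((Σ Cell λ z → b ≡δ⟨ k , false ⟩ z × z ≡δ⟨ ℓ , true ⟩ b') ×
         a ≡δ⟨ k , false ⟩ b' × c ≡δ⟨ ℓ , true ⟩ b')
      ⊎
        ((Σ Cell λ z → b ≡δ⟨ k , true ⟩ z × z ≡δ⟨ ℓ , false ⟩ b') ×
         a ≡δ⟨ ℓ , false ⟩ b' × c ≡δ⟨ k , true ⟩ b'))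

  Adj : List Cell → List Cell → Set
  Adj xs ys = Adj₀ xs ys ⊎ Adj₀ ys xs

  _∼_ : List Cell → List Cell → Set
  _∼_ = Star Adj

  PathSet : Set₁
  PathSet = List Cell → Set

  Class : List Cell → PathSet
  Class xs ys = ys ∼ xs

  -- An n-cube of the unfolding: a set S of sequences together with a
  -- representative pointed cube path (pre, x) with x ∈ X n such that
  -- S = [pre ∷ʳ (n , x)].
  X̃ : ℕ → Set₁
  X̃ n = Σ PathSet λ S → Σ (List Cell) λ pre → Σ (X n) λ x →
        IsPointedCubePath (pre ∷ʳ (n , x)) ×
        (∀ ys → S ys ⇔ Class (pre ∷ʳ (n , x)) ys)

  ⟦_⟧ : ∀ {n} → X̃ n → PathSet
  ⟦ S ⟧ = proj₁ S

  δ̃ : ∀ {n} → Fin (suc n) → Bool → X̃ (suc n) → PathSet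
  δ̃ {n} k false (S , pre , x , _) ys =
    Σ (List Cell) λ ys' → (ys ≡ ys' ∷ʳ (n , δ k false x)) ×
      ((ys ∷ʳ (suc n , x)) ∼ (pre ∷ʳ (suc n , x)))
  δ̃ {n} k true (S , pre , x , _) ys =
    ys ∼ ((pre ∷ʳ (suc n , x)) ∷ʳ (n , δ k true x))

  X̃Cell : Set₁
  X̃Cell = Σ ℕ X̃

  data _≐δ̃⟨_,_⟩_ : X̃Cell → ℕ → Bool → X̃Cell → Set₁ where
    tface : ∀ {n} (k : Fin (suc n)) (ν : Bool) (s : X̃ n) (t : X̃ (suc n)) →
            (∀ ys → ⟦ s ⟧ ys ⇔ δ̃ k ν t ys) →
            (n , s) ≐δ̃⟨ toℕ k , ν ⟩ (suc n , t)

  Step̃ : X̃Cell → X̃Cell → Set₁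
  Step̃ a b = ∃[ k ] (a ≐δ̃⟨ k , false ⟩ b ⊎ b ≐δ̃⟨ k , true ⟩ a)

  IsCubePathX̃ : List X̃Cell → Set₁
  IsCubePathX̃ = Linked Step̃

  IsBaseX̃ : X̃Cell → Set
  IsBaseX̃ (n , s) = (n ≡ 0) × (∀ ys → ⟦ s ⟧ ys ⇔ Class (base ∷ []) ys)

  IsPointedCubePathX̃ : List X̃Cell → Set₁
  IsPointedCubePathX̃ xs =
    Σ X̃Cell λ x₁ → Σ (List X̃Cell) λ rest →
      (xs ≡ x₁ ∷ rest) × IsBaseX̃ x₁ × IsCubePathX̃ xs

  π : X̃Cell → Cell
  π (n , S , pre , x , _) = (n , x)

-- Induction along the path x̃₁ … x̃ₘ, with the invariant that the class x̃ⱼ contains the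
-- projected prefix.  Forward along a δ⁰-face this is the definition of δ̃⁰: a member of
-- δ̃⁰ t is exactly a path whose extension by π t is homotopic to the representative of t.
-- Forward along a δ¹-face, a homotopy to the representative of t survives appending the
-- face; that the appended cell is π of the new class uses that homotopy fixes end points.
-- At the start, homotopy preserves length, so the base class [i] contains only (i).

module Submission where

open import Defs
open import Data.Nat using (suc)
open import Data.Bool using (true; false)
open import Data.Fin using (Fin; toℕ; zero; suc)
open import Data.List using (List; []; _∷_; _++_; _∷ʳ_; foldl; length; lookup; map; take)
open import Data.List.Properties using (++-assoc; foldl-++; foldl-∷ʳ; length-++)
open import Data.List.Relation.Unary.Linked using (_∷_)
open import Data.Product using (proj₂; _,_)
open import Data.Sum using (_⊎_; inj₁; inj₂)
open import Function.Bundles using (_⇔_; Equivalence)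
open import Level using (Level)
open import Relation.Binary.Core using (Rel; _⇒_)
open import Relation.Binary.PropositionalEquality using (_≡_; refl; sym; trans; subst; module ≡-Reasoning)
open import Relation.Binary.Construct.Closure.ReflexiveTransitive using (Star; ε; gmap; fold)

open Equivalence

private variable
  a b ℓ : Level
  A : Set a
  B : Set b

lastOr : A → List A → A
lastOr = foldl (λ _ y → y)

length-∷ʳ-≡1 : (xs : List A) (x : A) → length (xs ∷ʳ x) ≡ 1 → xs ≡ []
length-∷ʳ-≡1 []          x _  = refl
length-∷ʳ-≡1 (_ ∷ [])     x ()
length-∷ʳ-≡1 (_ ∷ _ ∷ _) x ()

Star-sym-invariant : {R : Rel A ℓ} (f : A → B) → (∀ {x y} → R x y → f x ≡ f y) →
                     Star (λ x y → R x y ⊎ R y x) ⇒ (λ x y → f x ≡ f y)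
Star-sym-invariant f inv = fold _ (λ { (inj₁ r) eq → trans (inv r) eq
                                     ; (inj₂ r) eq → trans (sym (inv r)) eq }) refl

MiddleBlind : (List A → B) → Set _
MiddleBlind f = ∀ pre a b b′ c post → f (pre ++ a ∷ b ∷ c ∷ post) ≡ f (pre ++ a ∷ b′ ∷ c ∷ post)

module UnfoldingPaths (P : PreCubical) (i : PreCubical.X P 0) where
  open Unfolding P i

  ∼-invariant : (f : List Cell → B) → MiddleBlind f → ∀ {xs ys} → xs ∼ ys → f xs ≡ f ys
  ∼-invariant f blind = Star-sym-invariant f λ
    { (pre , a , b , b′ , c , post , refl , refl , _) → blind pre a b b′ c post }

  ∼-length : ∀ {xs ys} → xs ∼ ys → length xs ≡ length ys
  ∼-length = ∼-invariant length λ pre _ _ _ _ _ →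
    trans (length-++ pre) (sym (length-++ pre))

  ∼-lastOr : ∀ {xs ys} → xs ∼ ys → lastOr base xs ≡ lastOr base ys
  ∼-lastOr = ∼-invariant (lastOr base) λ pre _ _ _ _ _ →
    trans (foldl-++ _ base pre _) (sym (foldl-++ _ base pre _))

  ∼-∷ʳ-last : ∀ {xs ys x y} → (xs ∷ʳ x) ∼ (ys ∷ʳ y) → x ≡ y
  ∼-∷ʳ-last {xs} {ys} {x} {y} r = begin
    x                      ≡⟨ foldl-∷ʳ _ base x xs ⟨
    lastOr base (xs ∷ʳ x)  ≡⟨ ∼-lastOr r ⟩
    lastOr base (ys ∷ʳ y)  ≡⟨ foldl-∷ʳ _ base y ys ⟩
    y                      ∎
    where open ≡-Reasoning

  Adj₀-∷ʳ : ∀ z {xs ys} → Adj₀ xs ys → Adj₀ (xs ∷ʳ z) (ys ∷ʳ z)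
  Adj₀-∷ʳ z (pre , a , b , b′ , c , post , refl , refl , faces) =
    pre , a , b , b′ , c , post ∷ʳ z ,
    ++-assoc pre (a ∷ b ∷ c ∷ post) _ , ++-assoc pre (a ∷ b′ ∷ c ∷ post) _ , faces

  ∼-∷ʳ : ∀ z {xs ys} → xs ∼ ys → (xs ∷ʳ z) ∼ (ys ∷ʳ z)
  ∼-∷ʳ z = gmap (_∷ʳ z) λ { (inj₁ r) → inj₁ (Adj₀-∷ʳ z r) ; (inj₂ r) → inj₂ (Adj₀-∷ʳ z r) }

  representative : ∀ {n} → X̃ n → List Cell
  representative {n} (_ , pre , x , _) = pre ∷ʳ (n , x)

  ∈-representative : ∀ {n} (s : X̃ n) → ⟦ s ⟧ (representative s)
  ∈-representative (_ , _ , _ , _ , ⟦s⟧⇔) = from (⟦s⟧⇔ _) ε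

  π-≡-endpoint : ∀ {n} (s : X̃ n) {zs c} → (∀ ys → ⟦ s ⟧ ys ⇔ Class (zs ∷ʳ c) ys) → π (n , s) ≡ c
  π-≡-endpoint s ⟦s⟧⇔ = ∼-∷ʳ-last (to (⟦s⟧⇔ _) (∈-representative s))

  -- L is the projection of the path before y.
  Traces : List Cell → X̃Cell → Set
  Traces L y = ⟦ proj₂ y ⟧ (L ∷ʳ π y)

  Traces-base : ∀ y → IsBaseX̃ y → Traces [] y
  Traces-base (_ , s@(_ , pre , x , _)) (_ , ⟦s⟧⇔[base]) =
    subst (λ L → ⟦ s ⟧ (L ∷ʳ π (_ , s))) (length-∷ʳ-≡1 pre _ (∼-length rep∼base))
      (∈-representative s)
    where
      rep∼base : representative s ∼ (base ∷ [])
      rep∼base = to (⟦s⟧⇔[base] _) (∈-representative s)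

  Traces-step : ∀ L {y y′} → Step̃ y y′ → Traces L y → Traces (L ∷ʳ π y) y′
  Traces-step L (_ , inj₁ (tface k false s (_ , _ , _ , _ , ⟦t⟧⇔) ⟦s⟧⇔)) L∷y∈s
    with _ , _ , L∷y∷t∼rep ← to (⟦s⟧⇔ _) L∷y∈s
    = from (⟦t⟧⇔ _) L∷y∷t∼rep
  Traces-step L (_ , inj₂ (tface {n} k true s (_ , pre , x , _ , ⟦t⟧⇔) ⟦s⟧⇔)) L∷y∈t =
    from (⟦s⟧⇔ _) (subst (λ c → ((L ∷ʳ (suc n , x)) ∷ʳ π (n , s)) ∼ ((pre ∷ʳ (suc n , x)) ∷ʳ c))
                         (π-≡-endpoint s ⟦s⟧⇔)
                         (∼-∷ʳ (π (n , s)) (to (⟦t⟧⇔ _) L∷y∈t)))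

  Traces-along : ∀ L y rest → IsCubePathX̃ (y ∷ rest) → Traces L y →
                 (j : Fin (length (y ∷ rest))) →
                 ⟦ proj₂ (lookup (y ∷ rest) j) ⟧ (L ++ map π (take (suc (toℕ j)) (y ∷ rest)))
  Traces-along L y rest        path         traced zero    = traced
  Traces-along L y (y′ ∷ rest) (step ∷ path) traced (suc j) =
    subst ⟦ proj₂ (lookup (y′ ∷ rest) j) ⟧
      (++-assoc L (π y ∷ []) (map π (take (suc (toℕ j)) (y′ ∷ rest))))
      (Traces-along (L ∷ʳ π y) y′ rest path (Traces-step L step traced) j)

  projected-prefix-∈ : (xs : List X̃Cell) → IsPointedCubePathX̃ xs → (j : Fin (length xs)) →
                       ⟦ proj₂ (lookup xs j) ⟧ (map π (take (suc (toℕ j)) xs))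
  projected-prefix-∈ _ (x₁ , rest , refl , x₁-base , path) =
    Traces-along [] x₁ rest path (Traces-base x₁ x₁-base)

lemma4p4 : (P : PreCubical) (i : PreCubical.X P 0) →
    let open Unfolding P i in
    (xs : List X̃Cell) → IsPointedCubePathX̃ xs →
    (j : Fin (length xs)) →
    ⟦ proj₂ (lookup xs j) ⟧ (map π (take (suc (toℕ j)) xs))
lemma4p4 P i = projected-prefix-∈
  where open UnfoldingPaths P i
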